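{- Let $n,p\in\mathbb{N}$ and $A\subseteq 2^{[n]}$. Then $|C^p[A]|\le |C^p[\mathcal{I}_{|A|}]|$.
   Context: $[n]=\{1,\dots,n\}$ and $2^{[n]}$ is its power set. The simplicial ordering on $2^{[n]}$: for distinct $x,y\in 2^{[n]}$, $x<y$ if either $|x|<|y|$, or $|x|=|y|$ and $\min(x\triangle y)\in x$. For $0\le m\le 2^n$, $\mathcal{I}_m$ denotes the set of the first $m$ elements of $2^{[n]}$ in the simplicial ordering. For $A\subseteq 2^{[n]}$, $C^p[A]=\{y\in 2^{[n]}: |x\triangle y|\le p \text{ for every } x\in A\}$. -}

module Defs where

open import Data.Bool using (Bool; true; false; _∧_; _∨_; if_then_else_; not; _xor_)
open import Data.Nat using (ℕ; zero; suc; _+_; _≤ᵇ_; _<ᵇ_; _≡ᵇ_)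
open import Data.List using (List; []; _∷_; map; _++_; length; filterᵇ)
open import Data.Vec using (Vec; []; _∷_)
open import Data.Fin.Subset using (Subset)

-- A subset x ⊆ [n] is a characteristic vector  Subset n = Vec Bool n ;
-- position i (0-based) stands for the element i+1 of [n].

allSubsets : (n : ℕ) → List (Subset n)
allSubsets zero    = [] ∷ []
allSubsets (suc n) = map (true ∷_) (allSubsets n) ++ map (false ∷_) (allSubsets n)

size : {n : ℕ} → Subset n → ℕ
size []          = 0
size (true ∷ x)  = suc (size x)
size (false ∷ x) = size x

symDiffSize : {n : ℕ} → Subset n → Subset n → ℕ
symDiffSize []      []      = 0
symDiffSize (a ∷ x) (b ∷ y) = (if a xor b then 1 else 0) + symDiffSize x y

-- minInX x y = true  iff  x ≠ y and  min (x △ y) ∈ x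
minInX : {n : ℕ} → Subset n → Subset n → Bool
minInX []          []      = false
minInX (true ∷ x)  (true ∷ y)  = minInX x y
minInX (false ∷ x) (false ∷ y) = minInX x y
minInX (true ∷ x)  (false ∷ y) = true
minInX (false ∷ x) (true ∷ y)  = false

-- simplicial ordering: x < y iff |x| < |y|, or |x| = |y| and min(x △ y) ∈ x
-- (minInX is false when x = y, so this is the strict order)
simplicialLt : {n : ℕ} → Subset n → Subset n → Bool
simplicialLt x y = (size x <ᵇ size y) ∨ ((size x ≡ᵇ size y) ∧ minInX x y)

Family : ℕ → Set
Family n = Subset n → Bool

card : {n : ℕ} → Family n → ℕ
card {n} A = length (filterᵇ A (allSubsets n))

-- I_m : the first m elements of 2^[n] in the simplicial ordering,
-- i.e. those x having fewer than m predecessors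
initialSegment : (n m : ℕ) → Family n
initialSegment n m x = length (filterᵇ (λ y → simplicialLt y x) (allSubsets n)) <ᵇ m

allᵇ : {X : Set} → (X → Bool) → List X → Bool
allᵇ f []       = true
allᵇ f (x ∷ xs) = f x ∧ allᵇ f xs

C : {n : ℕ} → ℕ → Family n → Family n
C {n} p A y = allᵇ (λ x → not (A x) ∨ (symDiffSize x y ≤ᵇ p)) (allSubsets n)

-- Harper's vertex-isoperimetric theorem: among families of m points of the cube, the initial
-- segment I_m of the simplicial order has the fewest points within distance r, for every r.
-- It is proved by induction on the dimension with compressions. Replacing each section of A
-- along a coordinate by the initial segment of the same size does not enlarge the neighbourhood
-- (by induction, since the neighbourhood of an initial segment is again one), and it strictly
-- lowers Σ_{x ∈ A} rank x unless nothing changes. A family all of whose sections are initial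
-- segments is either an initial segment itself or {z ≺ x} ∪ {∁ x} for a point x immediately
-- followed by its antipode ∁ x; that family is handled directly.
-- The theorem follows because y ∈ C^p[A] exactly when no point of A lies within distance
-- n − p − 1 of ∁ y, so that |C^p[A]| = 2^n − |ball_{n−p−1}(A)| whenever p < n.

module Submission where

open import Defs
open import Data.Bool using (Bool; true; false; T; not; _∧_; _∨_; _xor_; if_then_else_)
open import Data.Bool.Properties
  using (T?; T-∧; T-∨; ∧-zeroʳ; ∧-identityʳ; ∧-comm; xor-same; not-distribˡ-xor; not-involutive; ¬-not)
  renaming (_≟_ to _≟ᵇ_)
open import Data.Nat
  using (ℕ; zero; suc; _+_; _*_; _∸_; _^_; _⊔_; _≤_; _<_; z≤n; s≤s; z<s; s<s⁻¹; _≤ᵇ_; _<ᵇ_; _≡ᵇ_; _<?_; >-nonZero)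
open import Data.Nat.Properties
open import Data.Fin using (Fin; zero; suc; fromℕ)
open import Data.Fin.Subset using (Subset; ∁)
open import Data.Fin.Subset.Properties using (anySubset?)
open import Data.Fin.Properties using (any?)
open import Data.List using (List; []; _∷_; map; _++_; length; filterᵇ)
open import Data.List.Properties using (filter-++; length-++)
open import Data.List.Membership.Propositional using (_∈_)
open import Data.List.Membership.Propositional.Properties using (∈-++⁺ˡ; ∈-++⁺ʳ; ∈-map⁺)
open import Data.List.Relation.Unary.All as All using (All; []; _∷_)
open import Data.List.Relation.Unary.Any using (here)
open import Data.Vec using ([]; _∷_; insertAt; removeAt; lookup; last; _[_]≔_)
open import Data.Vec.Properties using (insertAt-lookup; removeAt-insertAt; insertAt-removeAt)
open import Data.Product using (∃; _×_; _,_; proj₁; proj₂)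
open import Data.Sum using (_⊎_; inj₁; inj₂; map₁; map₂; [_,_])
open import Data.Empty using (⊥-elim)
open import Function using (_∘_)
open import Function.Bundles using (Equivalence; _⇔_; mk⇔)
open import Relation.Nullary using (¬?; ¬_; yes; no; ⌊_⌋; fromWitness; toWitness; _×-dec_)
open import Relation.Nullary.Decidable using (decidable-stable)
open import Relation.Unary using (Pred; Decidable)
open import Level using (0ℓ)
open import Relation.Binary.PropositionalEquality
  using (_≡_; _≢_; _≗_; refl; sym; trans; cong; cong₂; subst; subst₂; module ≡-Reasoning)
open import Relation.Binary.Definitions using (tri<; tri≈; tri>)

open import Algebra.Properties.CommutativeSemigroup +-commutativeSemigroup using (interchange; x∙yz≈y∙xz)

open Equivalence using (to; from)

private variable n : ℕ

T-ext : ∀ {a b} → (T a → T b) → (T b → T a) → a ≡ b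
T-ext {true}  {true}  _ _ = refl
T-ext {true}  {false} f _ = ⊥-elim (f _)
T-ext {false} {true}  _ g = ⊥-elim (g _)
T-ext {false} {false} _ _ = refl

¬T⇒T-not : ∀ {b} → ¬ T b → T (not b)
¬T⇒T-not {false} _ = _
¬T⇒T-not {true}  f = f _

T-not⇒¬T : ∀ {b} → T (not b) → ¬ T b
T-not⇒¬T {false} _ ()

false≢true : false ≢ true
false≢true ()

≢-cases : ∀ a b → a ≢ b → T (a ∧ not b) ⊎ T (b ∧ not a)
≢-cases true  true  a≢b = ⊥-elim (a≢b refl)
≢-cases true  false _   = inj₁ _
≢-cases false true  _   = inj₂ _
≢-cases false false a≢b = ⊥-elim (a≢b refl)


-- Counting subfamilies of the cube

_⊆_ : Family n → Family n → Set
A ⊆ B = ∀ x → T (A x) → T (B x)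

weight : (Subset n → ℕ) → Family n → ℕ
weight {zero}  w A = if A [] then w [] else 0
weight {suc n} w A = weight (w ∘ (true ∷_)) (A ∘ (true ∷_)) + weight (w ∘ (false ∷_)) (A ∘ (false ∷_))

count : Family n → ℕ
count = weight (λ _ → 1)

weight-cong : ∀ (w : Subset n → ℕ) {A B : Family n} → A ≗ B → weight w A ≡ weight w B
weight-cong {zero}  w A≗B rewrite A≗B [] = refl
weight-cong {suc n} w A≗B =
  cong₂ _+_ (weight-cong _ (A≗B ∘ (true ∷_))) (weight-cong _ (A≗B ∘ (false ∷_)))

weight-mono : ∀ (w : Subset n → ℕ) {A B : Family n} → A ⊆ B → weight w A ≤ weight w B
weight-mono {zero} w {A} {B} A⊆B with A [] | B [] | A⊆B []
... | true  | true  | _ = ≤-refl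
... | true  | false | f = ⊥-elim (f _)
... | false | _     | _ = z≤n
weight-mono {suc n} w A⊆B =
  +-mono-≤ (weight-mono _ (A⊆B ∘ (true ∷_))) (weight-mono _ (A⊆B ∘ (false ∷_)))

count-cong : {A B : Family n} → A ≗ B → count A ≡ count B
count-cong = weight-cong (λ _ → 1)

count-mono : {A B : Family n} → A ⊆ B → count A ≤ count B
count-mono = weight-mono (λ _ → 1)

weight-∅ : ∀ (w : Subset n → ℕ) (A : Family n) → (∀ x → ¬ T (A x)) → weight w A ≡ 0
weight-∅ {zero} w A A≡∅ with A [] | A≡∅ []
... | true  | f = ⊥-elim (f _)
... | false | _ = refl
weight-∅ {suc n} w A A≡∅ = cong₂ _+_ (weight-∅ _ _ (A≡∅ ∘ (true ∷_))) (weight-∅ _ _ (A≡∅ ∘ (false ∷_)))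

weight-partition : ∀ (w : Subset n → ℕ) (A B : Family n) →
  weight w A ≡ weight w (λ x → A x ∧ B x) + weight w (λ x → A x ∧ not (B x))
weight-partition {zero} w A B with A [] | B []
... | true  | true  = sym (+-identityʳ _)
... | true  | false = refl
... | false | _     = refl
weight-partition {suc n} w A B =
  trans (cong₂ _+_ (weight-partition w₁ A₁ B₁) (weight-partition w₀ A₀ B₀))
        (interchange (weight w₁ (λ x → A₁ x ∧ B₁ x)) (weight w₁ (λ x → A₁ x ∧ not (B₁ x)))
                     (weight w₀ (λ x → A₀ x ∧ B₀ x)) (weight w₀ (λ x → A₀ x ∧ not (B₀ x))))
  where
  w₁ w₀ : Subset n → ℕ
  w₁ = w ∘ (true ∷_)
  w₀ = w ∘ (false ∷_)
  A₁ A₀ B₁ B₀ : Family n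
  A₁ = A ∘ (true ∷_)
  A₀ = A ∘ (false ∷_)
  B₁ = B ∘ (true ∷_)
  B₀ = B ∘ (false ∷_)

weight-≤ : ∀ (w : Subset n → ℕ) m (A : Family n) → (∀ x → T (A x) → w x ≤ m) → weight w A ≤ count A * m
weight-≤ {zero} w m A w≤m with A [] | w≤m []
... | true  | w[]≤m = subst (w [] ≤_) (sym (+-identityʳ m)) (w[]≤m _)
... | false | _     = z≤n
weight-≤ {suc n} w m A w≤m = begin
  weight (w ∘ (true ∷_)) (A ∘ (true ∷_)) + weight (w ∘ (false ∷_)) (A ∘ (false ∷_))
    ≤⟨ +-mono-≤ (weight-≤ _ m _ (w≤m ∘ (true ∷_))) (weight-≤ _ m _ (w≤m ∘ (false ∷_))) ⟩
  count (A ∘ (true ∷_)) * m + count (A ∘ (false ∷_)) * m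
    ≡⟨ *-distribʳ-+ m (count (A ∘ (true ∷_))) _ ⟨
  count A * m ∎
  where open ≤-Reasoning

weight-≥ : ∀ (w : Subset n → ℕ) m (A : Family n) → (∀ x → T (A x) → m ≤ w x) → count A * m ≤ weight w A
weight-≥ {zero} w m A m≤w with A [] | m≤w []
... | true  | m≤w[] = subst (_≤ w []) (sym (+-identityʳ m)) (m≤w[] _)
... | false | _     = z≤n
weight-≥ {suc n} w m A m≤w = begin
  count A * m
    ≡⟨ *-distribʳ-+ m (count (A ∘ (true ∷_))) _ ⟩
  count (A ∘ (true ∷_)) * m + count (A ∘ (false ∷_)) * m
    ≤⟨ +-mono-≤ (weight-≥ _ m _ (m≤w ∘ (true ∷_))) (weight-≥ _ m _ (m≤w ∘ (false ∷_))) ⟩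
  weight (w ∘ (true ∷_)) (A ∘ (true ∷_)) + weight (w ∘ (false ∷_)) (A ∘ (false ∷_)) ∎
  where open ≤-Reasoning

count-full : ∀ n → count {n} (λ _ → true) ≡ 2 ^ n
count-full zero    = refl
count-full (suc n) = cong₂ _+_ (count-full n) (trans (count-full n) (sym (+-identityʳ _)))

count-∨-disjoint : (A B : Family n) → (∀ x → T (A x) → ¬ T (B x)) →
  count (λ x → A x ∨ B x) ≡ count A + count B
count-∨-disjoint A B disjoint =
  trans (weight-partition _ (λ x → A x ∨ B x) A)
        (cong₂ _+_ (count-cong ∨-∧-absorb) (count-cong ∨-∧-not))
  where
  ∨-∧-absorb : ∀ x → (A x ∨ B x) ∧ A x ≡ A x
  ∨-∧-absorb x with A x
  ... | true  = refl
  ... | false = ∧-zeroʳ (B x)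
  ∨-∧-not : ∀ x → (A x ∨ B x) ∧ not (A x) ≡ B x
  ∨-∧-not x with A x | B x | disjoint x
  ... | true  | true  | d = ⊥-elim (d _ _)
  ... | true  | false | _ = refl
  ... | false | b     | _ = ∧-identityʳ b

count-complement : (A : Family n) → count A + count (not ∘ A) ≡ 2 ^ n
count-complement {n} A = trans (sym (weight-partition _ (λ _ → true) A)) (count-full n)

count-∘∁ : (F : Family n) → count (F ∘ ∁) ≡ count F
count-∘∁ {zero}  F = refl
count-∘∁ {suc n} F = trans (cong₂ _+_ (count-∘∁ (F ∘ (false ∷_))) (count-∘∁ (F ∘ (true ∷_))))
                           (+-comm (count (F ∘ (false ∷_))) _)

card≡count : (A : Family n) → card A ≡ count A
card≡count {zero} A with A []
... | true  = refl
... | false = refl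
card≡count {suc n} A = begin
  length (filterᵇ A (map (true ∷_) (allSubsets n) ++ map (false ∷_) (allSubsets n)))
    ≡⟨ cong length (filter-++ (T? ∘ A) (map (true ∷_) (allSubsets n)) _) ⟩
  length (filterᵇ A (map (true ∷_) (allSubsets n)) ++ filterᵇ A (map (false ∷_) (allSubsets n)))
    ≡⟨ length-++ (filterᵇ A (map (true ∷_) (allSubsets n))) ⟩
  length (filterᵇ A (map (true ∷_) (allSubsets n))) + length (filterᵇ A (map (false ∷_) (allSubsets n)))
    ≡⟨ cong₂ _+_ (trans (filter-map (true ∷_) (allSubsets n)) (card≡count (A ∘ (true ∷_))))
                 (trans (filter-map (false ∷_) (allSubsets n)) (card≡count (A ∘ (false ∷_)))) ⟩
  count A ∎
  where
  open ≡-Reasoning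
  filter-map : ∀ (f : Subset n → Subset (suc n)) xs → length (filterᵇ A (map f xs)) ≡ length (filterᵇ (A ∘ f) xs)
  filter-map f []       = refl
  filter-map f (x ∷ xs) with A (f x)
  ... | true  = cong suc (filter-map f xs)
  ... | false = filter-map f xs


dist : Subset n → Subset n → ℕ
dist = symDiffSize

dist-self : (x : Subset n) → dist x x ≡ 0
dist-self []          = refl
dist-self (true ∷ x)  = dist-self x
dist-self (false ∷ x) = dist-self x

dist≡0⇒≡ : (x y : Subset n) → dist x y ≡ 0 → x ≡ y
dist≡0⇒≡ []          []          _ = refl
dist≡0⇒≡ (true ∷ x)  (true ∷ y)  e = cong (true ∷_) (dist≡0⇒≡ x y e)
dist≡0⇒≡ (false ∷ x) (false ∷ y) e = cong (false ∷_) (dist≡0⇒≡ x y e)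

dist-triangle : (x z y : Subset n) → dist x y ≤ dist x z + dist z y
dist-triangle []          []          []          = z≤n
dist-triangle (true ∷ x)  (true ∷ z)  (true ∷ y)  = dist-triangle x z y
dist-triangle (false ∷ x) (false ∷ z) (false ∷ y) = dist-triangle x z y
dist-triangle (true ∷ x)  (true ∷ z)  (false ∷ y) = ≤-trans (s≤s (dist-triangle x z y)) (≤-reflexive (sym (+-suc _ _)))
dist-triangle (false ∷ x) (false ∷ z) (true ∷ y)  = ≤-trans (s≤s (dist-triangle x z y)) (≤-reflexive (sym (+-suc _ _)))
dist-triangle (true ∷ x)  (false ∷ z) (false ∷ y) = s≤s (dist-triangle x z y)
dist-triangle (false ∷ x) (true ∷ z)  (true ∷ y)  = s≤s (dist-triangle x z y)
dist-triangle (true ∷ x)  (false ∷ z) (true ∷ y)  =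
  ≤-trans (dist-triangle x z y) (≤-trans (n≤1+n _) (+-monoʳ-≤ (suc (dist x z)) (n≤1+n _)))
dist-triangle (false ∷ x) (true ∷ z)  (false ∷ y) =
  ≤-trans (dist-triangle x z y) (≤-trans (n≤1+n _) (+-monoʳ-≤ (suc (dist x z)) (n≤1+n _)))

dist-split : (x y : Subset n) (r : ℕ) → dist x y ≤ suc r → ∃ λ z → dist x z ≤ r × dist z y ≤ 1
dist-split []          []          r _ = [] , z≤n , z≤n
dist-split (true ∷ x)  (true ∷ y)  r p = let (z , xz , zy) = dist-split x y r p in true ∷ z , xz , zy
dist-split (false ∷ x) (false ∷ y) r p = let (z , xz , zy) = dist-split x y r p in false ∷ z , xz , zy
dist-split (true ∷ x)  (false ∷ y) r (s≤s p) = true ∷ y , p , s≤s (≤-reflexive (dist-self y))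
dist-split (false ∷ x) (true ∷ y)  r (s≤s p) = false ∷ y , p , s≤s (≤-reflexive (dist-self y))

dist≤n : (x y : Subset n) → dist x y ≤ n
dist≤n []          []          = z≤n
dist≤n (true ∷ x)  (true ∷ y)  = m≤n⇒m≤1+n (dist≤n x y)
dist≤n (false ∷ x) (false ∷ y) = m≤n⇒m≤1+n (dist≤n x y)
dist≤n (true ∷ x)  (false ∷ y) = s≤s (dist≤n x y)
dist≤n (false ∷ x) (true ∷ y)  = s≤s (dist≤n x y)

dist-∁ : (x y : Subset n) → dist x y + dist x (∁ y) ≡ n
dist-∁ []          []          = refl
dist-∁ (true ∷ x)  (true ∷ y)  = trans (+-suc (dist x y) _) (cong suc (dist-∁ x y))
dist-∁ (false ∷ x) (false ∷ y) = trans (+-suc (dist x y) _) (cong suc (dist-∁ x y))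
dist-∁ (true ∷ x)  (false ∷ y) = cong suc (dist-∁ x y)
dist-∁ (false ∷ x) (true ∷ y)  = cong suc (dist-∁ x y)

-- A ball of radius 0, so that membership computes on cons cells.
⁅_⁆ : Subset n → Family n
⁅ x ⁆ z = dist z x ≡ᵇ 0

∈⁅⁆⇒≡ : (x z : Subset n) → T (⁅ x ⁆ z) → z ≡ x
∈⁅⁆⇒≡ x z z∈x = dist≡0⇒≡ z x (≡ᵇ⇒≡ _ 0 z∈x)

∈⁅⁆ : (x : Subset n) → T (⁅ x ⁆ x)
∈⁅⁆ x = ≡⇒≡ᵇ _ 0 (dist-self x)

count-⁅⁆ : (x : Subset n) → count ⁅ x ⁆ ≡ 1
count-⁅⁆ []          = refl
count-⁅⁆ (true ∷ x)  = cong₂ _+_ (count-⁅⁆ x) (weight-∅ _ (λ z → ⁅ true ∷ x ⁆ (false ∷ z)) (λ _ ()))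
count-⁅⁆ (false ∷ x) = cong₂ _+_ (weight-∅ _ (λ z → ⁅ false ∷ x ⁆ (true ∷ z)) (λ _ ())) (count-⁅⁆ x)

count-insert : (A : Family n) (x : Subset n) → ¬ T (A x) → count (λ z → A z ∨ ⁅ x ⁆ z) ≡ suc (count A)
count-insert A x x∉A =
  trans (count-∨-disjoint A ⁅ x ⁆ (λ z z∈A z≡x → x∉A (subst (T ∘ A) (∈⁅⁆⇒≡ x z z≡x) z∈A)))
        (trans (cong (count A +_) (count-⁅⁆ x)) (+-comm (count A) 1))

count-pos : (A : Family n) (x : Subset n) → T (A x) → 0 < count A
count-pos A x x∈A = ≤-trans (≤-reflexive (sym (count-⁅⁆ x)))
  (count-mono {A = ⁅ x ⁆} {A} (λ z z≡x → subst (T ∘ A) (sym (∈⁅⁆⇒≡ x z z≡x)) x∈A))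

count-witness : (A : Family n) → 0 < count A → ∃ λ x → T (A x)
count-witness A 0<∣A∣ with anySubset? (λ x → T? (A x))
... | yes witness = witness
... | no  empty   = ⊥-elim (<-irrefl (sym (weight-∅ _ A (λ x x∈A → empty (x , x∈A)))) 0<∣A∣)


-- The simplicial order

_≺_ : Subset n → Subset n → Set
x ≺ y = T (simplicialLt x y)

minInX-irrefl : (x : Subset n) → ¬ T (minInX x x)
minInX-irrefl (true ∷ x)  = minInX-irrefl x
minInX-irrefl (false ∷ x) = minInX-irrefl x

minInX-trans : (x y z : Subset n) → T (minInX x y) → T (minInX y z) → T (minInX x z)
minInX-trans []          []          []          () _
minInX-trans (true ∷ x)  (true ∷ y)  (true ∷ z)  p q = minInX-trans x y z p q
minInX-trans (false ∷ x) (false ∷ y) (false ∷ z) p q = minInX-trans x y z p q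
minInX-trans (true ∷ x)  (true ∷ y)  (false ∷ z) _ _ = _
minInX-trans (true ∷ x)  (false ∷ y) (false ∷ z) _ _ = _
minInX-trans (false ∷ x) (false ∷ y) (true ∷ z)  _ ()
minInX-trans (true ∷ x)  (false ∷ y) (true ∷ z)  _ ()

minInX-trichotomy : (x y : Subset n) → T (minInX x y) ⊎ x ≡ y ⊎ T (minInX y x)
minInX-trichotomy []          []          = inj₂ (inj₁ refl)
minInX-trichotomy (true ∷ x)  (false ∷ y) = inj₁ _
minInX-trichotomy (false ∷ x) (true ∷ y)  = inj₂ (inj₂ _)
minInX-trichotomy (true ∷ x)  (true ∷ y)  = map₂ (map₁ (cong (true ∷_))) (minInX-trichotomy x y)
minInX-trichotomy (false ∷ x) (false ∷ y) = map₂ (map₁ (cong (false ∷_))) (minInX-trichotomy x y)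

size<⇒≺ : (x y : Subset n) → size x < size y → x ≺ y
size<⇒≺ x y smaller = from T-∨ (inj₁ (<⇒<ᵇ smaller))

size≡⇒≺ : (x y : Subset n) → size x ≡ size y → T (minInX x y) → x ≺ y
size≡⇒≺ x y same-size p = from T-∨ (inj₂ (from T-∧ (≡⇒≡ᵇ _ _ same-size , p)))

≺-cases : (x y : Subset n) → x ≺ y → size x < size y ⊎ (size x ≡ size y × T (minInX x y))
≺-cases x y x≺y with to T-∨ x≺y
... | inj₁ smaller = inj₁ (<ᵇ⇒< _ _ smaller)
... | inj₂ p       = let (same-size , q) = to T-∧ p in inj₂ (≡ᵇ⇒≡ _ _ same-size , q)

≺-irrefl : (x : Subset n) → ¬ x ≺ x
≺-irrefl x x≺x with ≺-cases x x x≺x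
... | inj₁ smaller  = n≮n _ smaller
... | inj₂ (_ , p)  = minInX-irrefl x p

≺-trans : (x y z : Subset n) → x ≺ y → y ≺ z → x ≺ z
≺-trans x y z x≺y y≺z with ≺-cases x y x≺y | ≺-cases y z y≺z
... | inj₁ a       | inj₁ b       = size<⇒≺ x z (<-trans a b)
... | inj₁ a       | inj₂ (e , _) = size<⇒≺ x z (<-≤-trans a (≤-reflexive e))
... | inj₂ (e , _) | inj₁ b       = size<⇒≺ x z (≤-<-trans (≤-reflexive e) b)
... | inj₂ (e , a) | inj₂ (e′ , b) = size≡⇒≺ x z (trans e e′) (minInX-trans x y z a b)

≺-trichotomy : (x y : Subset n) → x ≺ y ⊎ x ≡ y ⊎ y ≺ x
≺-trichotomy x y with <-cmp (size x) (size y)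
... | tri< smaller _ _ = inj₁ (size<⇒≺ x y smaller)
... | tri> _ _ larger  = inj₂ (inj₂ (size<⇒≺ y x larger))
... | tri≈ _ e _ with minInX-trichotomy x y
...   | inj₁ p         = inj₁ (size≡⇒≺ x y e p)
...   | inj₂ (inj₁ eq) = inj₂ (inj₁ eq)
...   | inj₂ (inj₂ p)  = inj₂ (inj₂ (size≡⇒≺ y x (sym e) p))

size≡0⇒≡ : (x y : Subset n) → size x ≡ 0 → size y ≡ 0 → x ≡ y
size≡0⇒≡ []          []          _  _  = refl
size≡0⇒≡ (false ∷ x) (false ∷ y) ∣x∣ ∣y∣ = cong (false ∷_) (size≡0⇒≡ x y ∣x∣ ∣y∣)

minInX⇒nonempty : (x y : Subset n) → T (minInX x y) → 0 < size x
minInX⇒nonempty []          []          ()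
minInX⇒nonempty (true  ∷ x) y           _ = z<s
minInX⇒nonempty (false ∷ x) (false ∷ y) p = minInX⇒nonempty x y p

below : Subset n → Family n
below x z = simplicialLt z x

atMost : Subset n → Family n
atMost x z = simplicialLt z x ∨ ⁅ x ⁆ z

rank : Subset n → ℕ
rank x = count (below x)

corank : Subset n → ℕ
corank x = count (simplicialLt x)

count-atMost : (x : Subset n) → count (atMost x) ≡ suc (rank x)
count-atMost x = count-insert (below x) x (≺-irrefl x)

rank-mono : (x y : Subset n) → x ≺ y → rank x < rank y
rank-mono x y x≺y = subst (_≤ rank y) (count-atMost x) (count-mono ≼x⇒≺y)
  where
  ≼x⇒≺y : ∀ z → T (atMost x z) → z ≺ y
  ≼x⇒≺y z z≼x with to T-∨ z≼x
  ... | inj₁ z≺x = ≺-trans z x y z≺x x≺y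
  ... | inj₂ z≡x = subst (_≺ y) (sym (∈⁅⁆⇒≡ x z z≡x)) x≺y

corank-mono : (x y : Subset n) → x ≺ y → corank y < corank x
corank-mono x y x≺y = subst (_≤ corank x) (count-insert (simplicialLt y) y (≺-irrefl y)) (count-mono y≼⇒x≺)
  where
  y≼⇒x≺ : ∀ z → T (simplicialLt y z ∨ ⁅ y ⁆ z) → x ≺ z
  y≼⇒x≺ z y≼z with to T-∨ y≼z
  ... | inj₁ y≺z = ≺-trans x y z x≺y y≺z
  ... | inj₂ z≡y = subst (x ≺_) (sym (∈⁅⁆⇒≡ y z z≡y)) x≺y

minimal-element : (R : Subset n → Subset n → Bool) (f : Subset n → ℕ) → (∀ x y → T (R x y) → f x < f y) →
  {P : Pred (Subset n) 0ℓ} → Decidable P → ∀ x → P x → ∃ λ t → P t × (∀ z → P z → ¬ T (R z t))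
minimal-element R f f-mono {P} P? x Px = descend (suc (f x)) x ≤-refl Px
  where
  descend : ∀ k x → f x < k → P x → ∃ λ t → P t × (∀ z → P z → ¬ T (R z t))
  descend zero    x ()   Px
  descend (suc k) x fx<k Px with anySubset? (λ z → P? z ×-dec T? (R z x))
  ... | yes (z , Pz , Rzx) = descend k z (<-≤-trans (f-mono z x Rzx) (≤-pred fx<k)) Pz
  ... | no  none           = x , Px , λ z Pz Rzx → none (z , Pz , Rzx)

≺-minimal : {P : Pred (Subset n) 0ℓ} → Decidable P → ∀ x → P x → ∃ λ t → P t × (∀ z → P z → ¬ z ≺ t)
≺-minimal = minimal-element simplicialLt rank rank-mono

≺-maximal : {P : Pred (Subset n) 0ℓ} → Decidable P → ∀ x → P x → ∃ λ t → P t × (∀ z → P z → ¬ t ≺ z)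
≺-maximal = minimal-element (λ z t → simplicialLt t z) corank (λ x y → corank-mono y x)


-- Initial segments

segment : (n m : ℕ) → Family n
segment n m x = rank x <ᵇ m

initialSegment≗segment : (n m : ℕ) → initialSegment n m ≗ segment n m
initialSegment≗segment n m x = cong (_<ᵇ m) (card≡count (below x))

Downclosed : Family n → Set
Downclosed D = ∀ x y → x ≺ y → T (D y) → T (D x)

segment-downclosed : ∀ n m → Downclosed (segment n m)
segment-downclosed n m x y x≺y y∈I = <⇒<ᵇ (<-trans (rank-mono x y x≺y) (<ᵇ⇒< (rank y) m y∈I))

downclosed-cong : {D E : Family n} → D ≗ E → Downclosed D → Downclosed E
downclosed-cong D≗E D↓ x y x≺y y∈E = subst T (D≗E x) (D↓ x y x≺y (subst T (sym (D≗E y)) y∈E))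

downclosed⇒⊆below : (D : Family n) → Downclosed D → ∀ t → ¬ T (D t) → D ⊆ (below t)
downclosed⇒⊆below D D↓ t t∉D z z∈D with ≺-trichotomy z t
... | inj₁ z≺t        = z≺t
... | inj₂ (inj₁ z≡t) = ⊥-elim (t∉D (subst (T ∘ D) z≡t z∈D))
... | inj₂ (inj₂ t≺z) = ⊥-elim (t∉D (D↓ t z t≺z z∈D))

downclosed≗segment : (D : Family n) → Downclosed D → D ≗ segment n (count D)
downclosed≗segment D D↓ x with T? (D x)
... | yes x∈D = T-ext (λ _ → <⇒<ᵇ (subst (_≤ count D) (count-atMost x) (count-mono ≼x⊆D))) (λ _ → x∈D)
  where
  ≼x⊆D : ∀ z → T (atMost x z) → T (D z)
  ≼x⊆D z z≼x with to T-∨ z≼x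
  ... | inj₁ z≺x = D↓ z x z≺x x∈D
  ... | inj₂ z≡x = subst (T ∘ D) (sym (∈⁅⁆⇒≡ x z z≡x)) x∈D
... | no x∉D = T-ext (λ x∈D → ⊥-elim (x∉D x∈D))
                     (λ x∈I → ⊥-elim (<⇒≱ (<ᵇ⇒< _ _ x∈I) (count-mono (downclosed⇒⊆below D D↓ x x∉D))))

atMost-downclosed : (x : Subset n) → Downclosed (atMost x)
atMost-downclosed x w z w≺z z≼x with to T-∨ z≼x
... | inj₁ z≺x = from T-∨ (inj₁ (≺-trans w z x w≺z z≺x))
... | inj₂ z≡x = from T-∨ (inj₁ (subst (w ≺_) (∈⁅⁆⇒≡ x z z≡x) w≺z))

downclosed-count≡rank : (D : Family n) → Downclosed D → ∀ t → ¬ T (D t) → (∀ z → ¬ T (D z) → ¬ z ≺ t) →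
  count D ≡ rank t
downclosed-count≡rank D D↓ t t∉D t-min =
  ≤-antisym (count-mono (downclosed⇒⊆below D D↓ t t∉D))
            (count-mono (λ z z≺t → decidable-stable (T? (D z)) (λ z∉D → t-min z z∉D z≺t)))

count-segment-≤ : ∀ n m → count (segment n m) ≤ m
count-segment-≤ n m with anySubset? (λ x → T? (segment n m x))
... | no  empty     = subst (_≤ m) (sym (weight-∅ _ _ (λ x x∈I → empty (x , x∈I)))) z≤n
... | yes (x , x∈I) =
  let (t , t∈I , t-max) = ≺-maximal (T? ∘ segment n m) x x∈I in
  begin
    count (segment n m)                        ≤⟨ count-mono (I⊆≼t t t-max) ⟩
    count (atMost t)   ≡⟨ count-atMost t ⟩
    suc (rank t)                               ≤⟨ <ᵇ⇒< _ _ t∈I ⟩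
    m                                          ∎
  where
  open ≤-Reasoning
  I⊆≼t : ∀ t → (∀ z → T (segment n m z) → ¬ t ≺ z) → ∀ z → T (segment n m z) → T (atMost t z)
  I⊆≼t t t-max z z∈I with ≺-trichotomy z t
  ... | inj₁ z≺t        = from T-∨ (inj₁ z≺t)
  ... | inj₂ (inj₁ refl) = from T-∨ (inj₂ (∈⁅⁆ z))
  ... | inj₂ (inj₂ t≺z) = ⊥-elim (t-max z z∈I t≺z)

count-segment-≥ : ∀ n (B : Family n) → count B ≤ count (segment n (count B))
count-segment-≥ n B with anySubset? (λ x → ¬? (T? (segment n (count B) x)))
... | no  nothing-outside = begin
  count B                      ≤⟨ count-mono {A = B} {B = λ _ → true} (λ _ _ → _) ⟩
  count {n} (λ _ → true)       ≤⟨ count-mono (λ x _ → decidable-stable (T? _) (λ x∉I → nothing-outside (x , x∉I))) ⟩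
  count (segment n (count B))  ∎
  where open ≤-Reasoning
... | yes (x , x∉I) =
  let (t , t∉I , t-min) = ≺-minimal (λ z → ¬? (T? (segment n (count B) z))) x x∉I in
  subst (count B ≤_) (sym (downclosed-count≡rank _ (segment-downclosed n (count B)) t t∉I t-min)) (≮⇒≥ (t∉I ∘ <⇒<ᵇ))

count-segment : ∀ n (B : Family n) → count (segment n (count B)) ≡ count B
count-segment n B = ≤-antisym (count-segment-≤ n (count B)) (count-segment-≥ n B)

segment-mono : ∀ n {a b} → a ≤ b → segment n a ⊆ segment n b
segment-mono n a≤b x x∈Iₐ = <⇒<ᵇ (<-≤-trans (<ᵇ⇒< _ _ x∈Iₐ) a≤b)

segment-∨ : ∀ n a b (y : Subset n) → T (segment n a y ∨ segment n b y) → T (segment n (a ⊔ b) y)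
segment-∨ n a b y y∈I with to T-∨ y∈I
... | inj₁ y∈Iₐ = <⇒<ᵇ (<-≤-trans (<ᵇ⇒< _ _ y∈Iₐ) (m≤m⊔n a b))
... | inj₂ y∈I_b = <⇒<ᵇ (<-≤-trans (<ᵇ⇒< _ _ y∈I_b) (m≤n⊔m a b))


-- Hamming balls

ball : ℕ → Family n → Family n
ball r A y = ⌊ anySubset? (λ x → T? (A x ∧ (dist x y ≤ᵇ r))) ⌋

ball-intro : ∀ r (A : Family n) x y → T (A x) → dist x y ≤ r → T (ball r A y)
ball-intro r A x y x∈A xy≤r = fromWitness (x , from T-∧ (x∈A , ≤⇒≤ᵇ xy≤r))

ball-elim : ∀ r (A : Family n) y → T (ball r A y) → ∃ λ x → T (A x) × dist x y ≤ r
ball-elim r A y y∈ball =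
  let (x , p) = toWitness y∈ball
      (x∈A , xy≤r) = to T-∧ p
  in x , x∈A , ≤ᵇ⇒≤ _ _ xy≤r

ball-mono : ∀ r {A B : Family n} → A ⊆ B → ball r A ⊆ ball r B
ball-mono r {A} {B} A⊆B y y∈ball =
  let (x , x∈A , xy≤r) = ball-elim r A y y∈ball in ball-intro r B x y (A⊆B x x∈A) xy≤r

ball-cong : ∀ r {A B : Family n} → A ≗ B → ball r A ≗ ball r B
ball-cong r A≗B y =
  T-ext (ball-mono r (λ x → subst T (A≗B x)) y) (ball-mono r (λ x → subst T (sym (A≗B x))) y)

ball-zero : (A : Family n) → ball 0 A ≗ A
ball-zero A y = T-ext
  (λ y∈ball → let (x , x∈A , xy≤0) = ball-elim 0 A y y∈ball in
              subst (T ∘ A) (dist≡0⇒≡ x y (n≤0⇒n≡0 xy≤0)) x∈A)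
  (λ y∈A → ball-intro 0 A y y y∈A (≤-reflexive (dist-self y)))

ball-suc : ∀ r (A : Family n) → ball (suc r) A ≗ ball 1 (ball r A)
ball-suc r A y = T-ext
  (λ y∈ball → let (x , x∈A , xy≤r+1) = ball-elim (suc r) A y y∈ball
                  (z , xz≤r , zy≤1) = dist-split x y r xy≤r+1
              in ball-intro 1 (ball r A) z y (ball-intro r A x z x∈A xz≤r) zy≤1)
  (λ y∈ball → let (z , z∈ball , zy≤1) = ball-elim 1 (ball r A) y y∈ball
                  (x , x∈A , xz≤r) = ball-elim r A z z∈ball
              in ball-intro (suc r) A x y x∈A
                   (≤-trans (dist-triangle x z y) (≤-trans (+-mono-≤ xz≤r zy≤1) (≤-reflexive (+-comm r 1)))))


-- Neighbourhoods of down-sets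

_≼_ : Subset n → Subset n → Set
x ≼ y = x ≺ y ⊎ x ≡ y

≼-cons : ∀ b {x y : Subset n} → x ≼ y → (b ∷ x) ≼ (b ∷ y)
≼-cons true  (inj₁ x≺y)  = inj₁ x≺y
≼-cons false (inj₁ x≺y)  = inj₁ x≺y
≼-cons b     (inj₂ refl) = inj₂ refl

downclosed-≼ : (D : Family n) → Downclosed D → ∀ x y → x ≼ y → T (D y) → T (D x)
downclosed-≼ D D↓ x y (inj₁ x≺y)  = D↓ x y x≺y
downclosed-≼ D D↓ x y (inj₂ refl) = λ y∈D → y∈D

size≡0⇒≼ : (x y : Subset n) → size x ≡ 0 → x ≼ y
size≡0⇒≼ x y ∣x∣≡0 with m≤n⇒m<n∨m≡n (z≤n {size y})
... | inj₁ 0<∣y∣ = inj₁ (size<⇒≺ x y (subst (_< size y) (sym ∣x∣≡0) 0<∣y∣))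
... | inj₂ 0≡∣y∣ = inj₂ (size≡0⇒≡ x y ∣x∣≡0 (sym 0≡∣y∣))

empty-or-nonempty : (x : Subset n) → size x ≡ 0 ⊎ 0 < size x
empty-or-nonempty x with size x
... | zero  = inj₁ refl
... | suc _ = inj₂ z<s

-- Removes the largest element. dropLast y is the ≺-least neighbour of y and is ≺-monotone,
-- which is what makes balls around down-sets down-sets.
dropLast : Subset n → Subset n
dropLast []      = []
dropLast (b ∷ x) = if size x ≡ᵇ 0 then false ∷ x else b ∷ dropLast x

dropLast-∷-empty : ∀ b (x : Subset n) → size x ≡ 0 → dropLast (b ∷ x) ≡ false ∷ x
dropLast-∷-empty b x ∣x∣≡0 rewrite ∣x∣≡0 = refl

dropLast-∷ : ∀ b (x : Subset n) → 0 < size x → dropLast (b ∷ x) ≡ b ∷ dropLast x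
dropLast-∷ b x 0<∣x∣ with size x | 0<∣x∣
... | suc _ | _ = refl

dropLast-size : (x : Subset n) → 0 < size x → suc (size (dropLast x)) ≡ size x
dropLast-size (b ∷ x) 0<∣bx∣ with size x in ∣x∣
dropLast-size (true  ∷ x) _ | zero  = refl
dropLast-size (true  ∷ x) _ | suc _ = cong suc (dropLast-size x (subst (0 <_) (sym ∣x∣) z<s))
dropLast-size (false ∷ x) 0<∣x∣ | zero = ⊥-elim (<-irrefl (sym ∣x∣) 0<∣x∣)
dropLast-size (false ∷ x) _ | suc _ = dropLast-size x (subst (0 <_) (sym ∣x∣) z<s)

dropLast-empty : (x : Subset n) → size x ≡ 0 → dropLast x ≡ x
dropLast-empty []          _     = refl
dropLast-empty (false ∷ x) ∣x∣≡0 rewrite ∣x∣≡0 = refl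

dropLast-size-≤ : (x : Subset n) → size (dropLast x) ≤ size x
dropLast-size-≤ x with size x in ∣x∣
... | zero  = ≤-reflexive (trans (cong size (dropLast-empty x ∣x∣)) ∣x∣)
... | suc _ = ≤-trans (n≤1+n _) (≤-reflexive (trans (dropLast-size x (subst (0 <_) (sym ∣x∣) z<s)) ∣x∣))

dist-dropLast : (y : Subset n) → dist (dropLast y) y ≤ 1
dist-dropLast []      = z≤n
dist-dropLast (b ∷ y) with empty-or-nonempty y
... | inj₁ ∣y∣≡0 rewrite dropLast-∷-empty b y ∣y∣≡0 | dist-self y with b
...   | true  = s≤s z≤n
...   | false = z≤n
dist-dropLast (true  ∷ y) | inj₂ 0<∣y∣ rewrite dropLast-∷ true  y 0<∣y∣ = dist-dropLast y
dist-dropLast (false ∷ y) | inj₂ 0<∣y∣ rewrite dropLast-∷ false y 0<∣y∣ = dist-dropLast y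

dropLast-least : (x y : Subset n) → dist x y ≤ 1 → dropLast y ≼ x
dropLast-least []      []      _ = inj₂ refl
dropLast-least (a ∷ x) (b ∷ y) xy≤1 with empty-or-nonempty y
... | inj₁ ∣y∣≡0 rewrite dropLast-∷-empty b y ∣y∣≡0 with a
...   | false = ≼-cons false (size≡0⇒≼ y x ∣y∣≡0)
...   | true  = inj₁ (size<⇒≺ (false ∷ y) (true ∷ x) (subst (_< suc (size x)) (sym ∣y∣≡0) z<s))
dropLast-least (a ∷ x) (b ∷ y) xy≤1 | inj₂ 0<∣y∣ rewrite dropLast-∷ b y 0<∣y∣ = cases a b xy≤1
  where
  cases : ∀ a b → dist (a ∷ x) (b ∷ y) ≤ 1 → (b ∷ dropLast y) ≼ (a ∷ x)
  cases true  true  xy≤1 = ≼-cons true  (dropLast-least x y xy≤1)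
  cases false false xy≤1 = ≼-cons false (dropLast-least x y xy≤1)
  cases false true  (s≤s xy≤0) rewrite dist≡0⇒≡ x y (n≤0⇒n≡0 xy≤0) =
    inj₁ (size≡⇒≺ (true ∷ dropLast y) (false ∷ y) (dropLast-size y 0<∣y∣) _)
  cases true  false (s≤s xy≤0) rewrite dist≡0⇒≡ x y (n≤0⇒n≡0 xy≤0) =
    inj₁ (size<⇒≺ (false ∷ dropLast y) (true ∷ y) (s≤s (dropLast-size-≤ y)))

dropLast-≼-cons : ∀ b (z y : Subset n) → 0 < size z → 0 < size y →
  dropLast z ≼ dropLast y → dropLast (b ∷ z) ≼ dropLast (b ∷ y)
dropLast-≼-cons b z y 0<∣z∣ 0<∣y∣ rewrite dropLast-∷ b z 0<∣z∣ | dropLast-∷ b y 0<∣y∣ = ≼-cons b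

dropLast-mono-level : (z y : Subset n) → size z ≡ size y → T (minInX z y) → dropLast z ≼ dropLast y
dropLast-mono-level []          []          _ ()
dropLast-mono-level (true  ∷ z) (true  ∷ y) ∣z∣+1≡∣y∣+1 p =
  let ∣z∣≡∣y∣ = suc-injective ∣z∣+1≡∣y∣+1 ; 0<∣z∣ = minInX⇒nonempty z y p in
  dropLast-≼-cons true z y 0<∣z∣ (subst (0 <_) ∣z∣≡∣y∣ 0<∣z∣) (dropLast-mono-level z y ∣z∣≡∣y∣ p)
dropLast-mono-level (false ∷ z) (false ∷ y) ∣z∣≡∣y∣ p =
  let 0<∣z∣ = minInX⇒nonempty z y p in
  dropLast-≼-cons false z y 0<∣z∣ (subst (0 <_) ∣z∣≡∣y∣ 0<∣z∣) (dropLast-mono-level z y ∣z∣≡∣y∣ p)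
dropLast-mono-level (false ∷ z) (true  ∷ y) _ ()
dropLast-mono-level (true  ∷ z) (false ∷ y) ∣z∣+1≡∣y∣ _
  rewrite dropLast-∷ false y (subst (0 <_) ∣z∣+1≡∣y∣ z<s) with empty-or-nonempty z
... | inj₁ ∣z∣≡0 rewrite dropLast-∷-empty true z ∣z∣≡0 = size≡0⇒≼ (false ∷ z) _ ∣z∣≡0
... | inj₂ 0<∣z∣ rewrite dropLast-∷ true z 0<∣z∣ =
  inj₁ (size≡⇒≺ (true ∷ dropLast z) (false ∷ dropLast y)
         (suc-injective (trans (cong suc (dropLast-size z 0<∣z∣))
                               (trans ∣z∣+1≡∣y∣ (sym (dropLast-size y (subst (0 <_) ∣z∣+1≡∣y∣ z<s)))))) _)

dropLast-mono : (z y : Subset n) → z ≺ y → dropLast z ≼ dropLast y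
dropLast-mono z y z≺y with ≺-cases z y z≺y
... | inj₂ (∣z∣≡∣y∣ , p) = dropLast-mono-level z y ∣z∣≡∣y∣ p
... | inj₁ ∣z∣<∣y∣ with empty-or-nonempty z
...   | inj₁ ∣z∣≡0 = size≡0⇒≼ (dropLast z) _ (trans (cong size (dropLast-empty z ∣z∣≡0)) ∣z∣≡0)
...   | inj₂ 0<∣z∣ = inj₁ (size<⇒≺ (dropLast z) (dropLast y) (s<s⁻¹ (subst₂ _<_ (sym (dropLast-size z 0<∣z∣))
                                                              (sym (dropLast-size y (<-trans 0<∣z∣ ∣z∣<∣y∣))) ∣z∣<∣y∣)))

ball-1-downclosed : (D : Family n) → Downclosed D → Downclosed (ball 1 D)
ball-1-downclosed D D↓ z y z≺y y∈N = ball-intro 1 D (dropLast z) z dropLast-z∈D (dist-dropLast z)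
  where
  dropLast-y∈D : T (D (dropLast y))
  dropLast-y∈D = let (x , x∈D , xy≤1) = ball-elim 1 D y y∈N in
                 downclosed-≼ D D↓ (dropLast y) x (dropLast-least x y xy≤1) x∈D
  dropLast-z∈D : T (D (dropLast z))
  dropLast-z∈D = downclosed-≼ D D↓ (dropLast z) (dropLast y) (dropLast-mono z y z≺y) dropLast-y∈D

ball-downclosed : ∀ r (D : Family n) → Downclosed D → Downclosed (ball r D)
ball-downclosed zero    D D↓ = downclosed-cong (λ y → sym (ball-zero D y)) D↓
ball-downclosed (suc r) D D↓ =
  downclosed-cong (λ y → sym (ball-suc r D y)) (ball-1-downclosed (ball r D) (ball-downclosed r D D↓))


-- Compression along a coordinate

size-insertAt : (x : Subset n) (i : Fin (suc n)) (v : Bool) → size (insertAt x i v) ≡ (if v then 1 else 0) + size x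
size-insertAt x           zero    true  = refl
size-insertAt x           zero    false = refl
size-insertAt (true ∷ x)  (suc i) v     = trans (cong suc (size-insertAt x i v)) (sym (+-suc _ (size x)))
size-insertAt (false ∷ x) (suc i) v     = size-insertAt x i v

minInX-insertAt : (x y : Subset n) (i : Fin (suc n)) (v : Bool) →
  minInX (insertAt x i v) (insertAt y i v) ≡ minInX x y
minInX-insertAt x           y           zero    true  = refl
minInX-insertAt x           y           zero    false = refl
minInX-insertAt (true ∷ x)  (true ∷ y)  (suc i) v     = minInX-insertAt x y i v
minInX-insertAt (false ∷ x) (false ∷ y) (suc i) v     = minInX-insertAt x y i v
minInX-insertAt (true ∷ x)  (false ∷ y) (suc i) v     = refl
minInX-insertAt (false ∷ x) (true ∷ y)  (suc i) v     = refl

simplicialLt-insertAt : (x y : Subset n) (i : Fin (suc n)) (v : Bool) →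
  simplicialLt (insertAt x i v) (insertAt y i v) ≡ simplicialLt x y
simplicialLt-insertAt x y i v
  rewrite size-insertAt x i v | size-insertAt y i v | minInX-insertAt x y i v with v
... | true  = refl
... | false = refl

dist-insertAt : (x y : Subset n) (i : Fin (suc n)) (a b : Bool) →
  dist (insertAt x i a) (insertAt y i b) ≡ (if a xor b then 1 else 0) + dist x y
dist-insertAt x       y       zero    a b = refl
dist-insertAt (c ∷ x) (e ∷ y) (suc i) a b = begin
  (if c xor e then 1 else 0) + dist (insertAt x i a) (insertAt y i b)
    ≡⟨ cong ((if c xor e then 1 else 0) +_) (dist-insertAt x y i a b) ⟩
  (if c xor e then 1 else 0) + ((if a xor b then 1 else 0) + dist x y)
    ≡⟨ x∙yz≈y∙xz (if c xor e then 1 else 0) (if a xor b then 1 else 0) (dist x y) ⟩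
  (if a xor b then 1 else 0) + ((if c xor e then 1 else 0) + dist x y) ∎
  where open ≡-Reasoning

section : Fin (suc n) → Bool → Family (suc n) → Family n
section i v A y = A (insertAt y i v)

weight-sections : (i : Fin (suc n)) (w : Subset (suc n) → ℕ) (A : Family (suc n)) →
  weight w A ≡ weight (λ y → w (insertAt y i true)) (section i true A) + weight (λ y → w (insertAt y i false)) (section i false A)
weight-sections zero    w A = refl
weight-sections {suc n} (suc i) w A =
  trans (cong₂ _+_ (weight-sections i (w ∘ (true ∷_)) (A ∘ (true ∷_))) (weight-sections i (w ∘ (false ∷_)) (A ∘ (false ∷_))))
        (interchange (weight _ (section i true  (A ∘ (true ∷_))))  (weight _ (section i false (A ∘ (true ∷_))))
                     (weight _ (section i true  (A ∘ (false ∷_)))) (weight _ (section i false (A ∘ (false ∷_)))))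

compress : Fin (suc n) → Family (suc n) → Family (suc n)
compress {n} i A x = segment n (count (section i (lookup x i) A)) (removeAt x i)

section-compress : (i : Fin (suc n)) (v : Bool) (A : Family (suc n)) →
  section i v (compress i A) ≗ segment n (count (section i v A))
section-compress {n} i v A y
  rewrite insertAt-lookup y i v | removeAt-insertAt y i v = refl

count-compress : (i : Fin (suc n)) (A : Family (suc n)) → count (compress i A) ≡ count A
count-compress {n} i A = begin
  count (compress i A)
    ≡⟨ weight-sections i _ (compress i A) ⟩
  count (section i true (compress i A)) + count (section i false (compress i A))
    ≡⟨ cong₂ _+_ (trans (count-cong (section-compress i true A))  (count-segment n (section i true A)))
                 (trans (count-cong (section-compress i false A)) (count-segment n (section i false A))) ⟩
  count (section i true A) + count (section i false A)
    ≡⟨ weight-sections i _ A ⟨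
  count A ∎
  where open ≡-Reasoning

ball-1-insertAt : (i : Fin (suc n)) (v : Bool) (A : Family (suc n)) (y : Subset n) →
  ball 1 A (insertAt y i v) ≡ ball 1 (section i v A) y ∨ A (insertAt y i (not v))
ball-1-insertAt i v A y = T-ext forward backward
  where
  neighbour : ∀ c v x → T (A (insertAt x i c)) → (if c xor v then 1 else 0) + dist x y ≤ 1 →
    T (ball 1 (section i v A) y ∨ A (insertAt y i (not v)))
  neighbour true  true  x x∈A xy≤1 = from T-∨ (inj₁ (ball-intro 1 (section i true A) x y x∈A xy≤1))
  neighbour false false x x∈A xy≤1 = from T-∨ (inj₁ (ball-intro 1 (section i false A) x y x∈A xy≤1))
  neighbour true  false x x∈A (s≤s xy≤0) =
    from T-∨ (inj₂ (subst (λ x → T (A (insertAt x i true))) (dist≡0⇒≡ x y (n≤0⇒n≡0 xy≤0)) x∈A))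
  neighbour false true  x x∈A (s≤s xy≤0) =
    from T-∨ (inj₂ (subst (λ x → T (A (insertAt x i false))) (dist≡0⇒≡ x y (n≤0⇒n≡0 xy≤0)) x∈A))
  forward : T (ball 1 A (insertAt y i v)) → T (ball 1 (section i v A) y ∨ A (insertAt y i (not v)))
  forward y∈N =
    let (x , x∈A , xy≤1) = ball-elim 1 A _ y∈N
        x≡ = sym (insertAt-removeAt x i)
    in neighbour (lookup x i) v (removeAt x i) (subst (T ∘ A) x≡ x∈A)
         (subst (_≤ 1) (dist-insertAt (removeAt x i) y i (lookup x i) v)
           (subst (λ x → dist x (insertAt y i v) ≤ 1) x≡ xy≤1))
  backward : T (ball 1 (section i v A) y ∨ A (insertAt y i (not v))) → T (ball 1 A (insertAt y i v))
  backward p with to T-∨ p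
  ... | inj₁ y∈N =
    let (x , x∈A , xy≤1) = ball-elim 1 (section i v A) y y∈N in
    ball-intro 1 A (insertAt x i v) (insertAt y i v) x∈A
      (subst (_≤ 1) (sym (trans (dist-insertAt x y i v v) (cong (λ b → (if b then 1 else 0) + dist x y) (xor-same v)))) xy≤1)
  ... | inj₂ y∈A =
    ball-intro 1 A (insertAt y i (not v)) (insertAt y i v) y∈A
      (≤-reflexive (trans (dist-insertAt y y i (not v) v) (cong₂ (λ b d → (if b then 1 else 0) + d) not-v-xor-v (dist-self y))))
    where
    not-v-xor-v : not v xor v ≡ true
    not-v-xor-v = trans (sym (not-distribˡ-xor v v)) (cong not (xor-same v))

count-ball-1-sections : (i : Fin (suc n)) (A : Family (suc n)) →
  count (ball 1 A) ≡ count (λ y → ball 1 (section i true A) y ∨ A (insertAt y i false))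
                   + count (λ y → ball 1 (section i false A) y ∨ A (insertAt y i true))
count-ball-1-sections i A =
  trans (weight-sections i _ (ball 1 A))
        (cong₂ _+_ (count-cong (ball-1-insertAt i true A)) (count-cong (ball-1-insertAt i false A)))

Harper : ℕ → Set
Harper n = (B : Family n) → count (ball 1 (segment n (count B))) ≤ count (ball 1 B)

compress-ball-section-≤ : Harper n → (i : Fin (suc n)) (v : Bool) (A : Family (suc n)) →
  count (λ y → ball 1 (section i v (compress i A)) y ∨ compress i A (insertAt y i (not v)))
    ≤ count (λ y → ball 1 (section i v A) y ∨ A (insertAt y i (not v)))
compress-ball-section-≤ {n} harper i v A = begin
  count (λ y → ball 1 (section i v (compress i A)) y ∨ compress i A (insertAt y i (not v)))
    ≤⟨ count-mono (λ y p → segment-∨ n a′ b y (subst T (cong₂ _∨_ (ball-segment y) (section-compress i (not v) A y)) p)) ⟩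
  count (segment n (a′ ⊔ b))
    ≤⟨ count-segment-≤ n (a′ ⊔ b) ⟩
  a′ ⊔ b
    ≤⟨ ⊔-lub (≤-trans (harper (section i v A)) (count-mono {B = U} (λ y p → from T-∨ (inj₁ p))))
             (count-mono {B = U} (λ y p → from T-∨ (inj₂ p))) ⟩
  count U ∎
  where
  open ≤-Reasoning
  a b a′ : ℕ
  a = count (section i v A)
  b = count (section i (not v) A)
  a′ = count (ball 1 (segment n a))
  U : Family n
  U y = ball 1 (section i v A) y ∨ A (insertAt y i (not v))
  ball-segment : ball 1 (section i v (compress i A)) ≗ segment n a′
  ball-segment y = trans (ball-cong 1 (section-compress i v A) y)
                         (downclosed≗segment _ (ball-1-downclosed _ (segment-downclosed n a)) y)

compress-ball-≤ : Harper n → (i : Fin (suc n)) (A : Family (suc n)) → count (ball 1 (compress i A)) ≤ count (ball 1 A)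
compress-ball-≤ harper i A =
  subst₂ _≤_ (sym (count-ball-1-sections i (compress i A))) (sym (count-ball-1-sections i A))
    (+-mono-≤ (compress-ball-section-≤ harper i true A) (compress-ball-section-≤ harper i false A))


-- The potential Σ rank

StrictlyMonotone : (Subset n → ℕ) → Set
StrictlyMonotone w = ∀ x y → x ≺ y → w x < w y

-- For the ≺-largest t ∈ F, w ≤ w t on F and w > w t on G.
weight-separated-< : (w : Subset n → ℕ) → StrictlyMonotone w → (F G : Family n) → count F ≡ count G →
  (∀ f g → T (F f) → T (G g) → f ≺ g) → 0 < count F → weight w F < weight w G
weight-separated-< w w-mono F G ∣F∣≡∣G∣ F≺G 0<∣F∣ =
  let (f , f∈F) = count-witness F 0<∣F∣ ; (t , t∈F , t-max) = ≺-maximal (T? ∘ F) f f∈F in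
  separated-by t t∈F t-max
  where
  separated-by : ∀ t → T (F t) → (∀ z → T (F z) → ¬ t ≺ z) → weight w F < weight w G
  separated-by t t∈F t-max = begin-strict
    weight w F           ≤⟨ weight-≤ w (w t) F below-t ⟩
    count F * w t        <⟨ *-monoʳ-< (count F) {{>-nonZero 0<∣F∣}} (n<1+n (w t)) ⟩
    count F * suc (w t)  ≡⟨ cong (_* suc (w t)) ∣F∣≡∣G∣ ⟩
    count G * suc (w t)  ≤⟨ weight-≥ w (suc (w t)) G (λ x x∈G → w-mono t x (F≺G t x t∈F x∈G)) ⟩
    weight w G           ∎
    where
    open ≤-Reasoning
    below-t : ∀ x → T (F x) → w x ≤ w t
    below-t x x∈F with ≺-trichotomy x t
    ... | inj₁ x≺t         = <⇒≤ (w-mono x t x≺t)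
    ... | inj₂ (inj₁ refl) = ≤-refl
    ... | inj₂ (inj₂ t≺x)  = ⊥-elim (t-max x x∈F t≺x)

weight-separated-≤ : (w : Subset n → ℕ) → StrictlyMonotone w → (F G : Family n) → count F ≡ count G →
  (∀ f g → T (F f) → T (G g) → f ≺ g) → weight w F ≤ weight w G
weight-separated-≤ w w-mono F G ∣F∣≡∣G∣ F≺G with m≤n⇒m<n∨m≡n (z≤n {count F})
... | inj₁ 0<∣F∣ = <⇒≤ (weight-separated-< w w-mono F G ∣F∣≡∣G∣ F≺G 0<∣F∣)
... | inj₂ 0≡∣F∣ = ≤-trans (≤-reflexive (weight-∅ w F (λ x x∈F → <-irrefl 0≡∣F∣ (count-pos F x x∈F)))) z≤n

module _ (w : Subset n → ℕ) (w-mono : StrictlyMonotone w) (J S : Family n)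
         (J↓ : Downclosed J) (∣J∣≡∣S∣ : count J ≡ count S) where

  private
    J∖S S∖J : Family n
    J∖S x = J x ∧ not (S x)
    S∖J x = S x ∧ not (J x)

    split-J : ∀ u → weight u J ≡ weight u (λ x → J x ∧ S x) + weight u J∖S
    split-J u = weight-partition u J S

    split-S : ∀ u → weight u S ≡ weight u (λ x → J x ∧ S x) + weight u S∖J
    split-S u = trans (weight-partition u S J) (cong (_+ weight u S∖J) (weight-cong u (λ x → ∧-comm (S x) (J x))))

    ∣J∖S∣≡∣S∖J∣ : count J∖S ≡ count S∖J
    ∣J∖S∣≡∣S∖J∣ = +-cancelˡ-≡ (count (λ x → J x ∧ S x)) _ _ (trans (sym (split-J _)) (trans ∣J∣≡∣S∣ (split-S _)))

    J∖S≺S∖J : ∀ f g → T (J∖S f) → T (S∖J g) → f ≺ g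
    J∖S≺S∖J f g f∈J∖S g∈S∖J =
      downclosed⇒⊆below J J↓ g (T-not⇒¬T (proj₂ (to T-∧ g∈S∖J))) f (proj₁ (to T-∧ f∈J∖S))

  weight-downclosed-≤ : weight w J ≤ weight w S
  weight-downclosed-≤ =
    subst₂ _≤_ (sym (split-J w)) (sym (split-S w))
      (+-monoʳ-≤ (weight w (λ x → J x ∧ S x)) (weight-separated-≤ w w-mono J∖S S∖J ∣J∖S∣≡∣S∖J∣ J∖S≺S∖J))

  weight-downclosed-< : ∀ y → J y ≢ S y → weight w J < weight w S
  weight-downclosed-< y Jy≢Sy =
    subst₂ _<_ (sym (split-J w)) (sym (split-S w))
      (+-monoʳ-< (weight w (λ x → J x ∧ S x))
                 (weight-separated-< w w-mono J∖S S∖J ∣J∖S∣≡∣S∖J∣ J∖S≺S∖J 0<∣J∖S∣))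
    where
    0<∣J∖S∣ : 0 < count J∖S
    0<∣J∖S∣ with ≢-cases (J y) (S y) Jy≢Sy
    ... | inj₁ y∈J∖S = count-pos J∖S y y∈J∖S
    ... | inj₂ y∈S∖J = subst (0 <_) (sym ∣J∖S∣≡∣S∖J∣) (count-pos S∖J y y∈S∖J)

potential : Family n → ℕ
potential = weight rank

compress-potential-< : (i : Fin (suc n)) (A : Family (suc n)) (x : Subset (suc n)) →
  compress i A x ≢ A x → potential (compress i A) < potential A
compress-potential-< {n} i A x changed =
  subst₂ _<_ (sym (weight-sections i rank (compress i A))) (sym (weight-sections i rank A)) (sum-< (lookup x i) refl)
  where
  w : Bool → Subset n → ℕ
  w v y = rank (insertAt y i v)
  w-mono : ∀ v → StrictlyMonotone (w v)
  w-mono v y z y≺z = rank-mono (insertAt y i v) (insertAt z i v) (subst T (sym (simplicialLt-insertAt y z i v)) y≺z)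
  J : Bool → Family n
  J v = segment n (count (section i v A))
  J↓ : ∀ v → Downclosed (J v)
  J↓ v = segment-downclosed n (count (section i v A))
  J-weight≡ : ∀ v → weight (w v) (section i v (compress i A)) ≡ weight (w v) (J v)
  J-weight≡ v = weight-cong (w v) (section-compress i v A)
  ≤-at : ∀ v → weight (w v) (section i v (compress i A)) ≤ weight (w v) (section i v A)
  ≤-at v = subst (_≤ weight (w v) (section i v A)) (sym (J-weight≡ v))
    (weight-downclosed-≤ (w v) (w-mono v) (J v) (section i v A) (J↓ v) (count-segment n (section i v A)))
  <-at : ∀ v → lookup x i ≡ v → weight (w v) (section i v (compress i A)) < weight (w v) (section i v A)
  <-at v refl = subst (_< weight (w v) (section i v A)) (sym (J-weight≡ v))
    (weight-downclosed-< (w v) (w-mono v) (J v) (section i v A) (J↓ v) (count-segment n (section i v A))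
      (removeAt x i) (λ eq → changed (trans eq (cong A (insertAt-removeAt x i)))))
  sum-< : ∀ v → lookup x i ≡ v →
    weight (w true) (section i true (compress i A)) + weight (w false) (section i false (compress i A))
      < weight (w true) (section i true A) + weight (w false) (section i false A)
  sum-< true  xᵢ≡v = +-mono-<-≤ (<-at true xᵢ≡v) (≤-at false)
  sum-< false xᵢ≡v = +-mono-≤-< (≤-at true) (<-at false xᵢ≡v)


-- Families compressed in every direction

size-∁ : (x : Subset n) → size x + size (∁ x) ≡ n
size-∁ []          = refl
size-∁ (true ∷ x)  = cong suc (size-∁ x)
size-∁ (false ∷ x) = trans (+-suc (size x) _) (cong suc (size-∁ x))

minInX-∁ : (x y : Subset n) → minInX (∁ x) (∁ y) ≡ minInX y x
minInX-∁ []          []          = refl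
minInX-∁ (true ∷ x)  (true ∷ y)  = minInX-∁ x y
minInX-∁ (false ∷ x) (false ∷ y) = minInX-∁ x y
minInX-∁ (true ∷ x)  (false ∷ y) = refl
minInX-∁ (false ∷ x) (true ∷ y)  = refl

∁-involutive : (x : Subset n) → ∁ (∁ x) ≡ x
∁-involutive []      = refl
∁-involutive (b ∷ x) = cong₂ _∷_ (not-involutive b) (∁-involutive x)

∁-injective : {x y : Subset n} → ∁ x ≡ ∁ y → x ≡ y
∁-injective {x = x} {y} ∁x≡∁y = trans (sym (∁-involutive x)) (trans (cong ∁ ∁x≡∁y) (∁-involutive y))

last-∁ : (x : Subset (suc n)) → last (∁ x) ≡ not (last x)
last-∁ (b ∷ [])    = refl
last-∁ (b ∷ c ∷ x) = last-∁ (c ∷ x)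

size≡0⇒last≡false : (x : Subset (suc n)) → size x ≡ 0 → last x ≡ false
size≡0⇒last≡false (false ∷ [])    _     = refl
size≡0⇒last≡false (false ∷ c ∷ x) ∣x∣≡0 = size≡0⇒last≡false (c ∷ x) ∣x∣≡0

last-dropLast : (y : Subset (suc n)) → last (dropLast y) ≡ false
last-dropLast (b ∷ [])    = refl
last-dropLast (b ∷ c ∷ y) with empty-or-nonempty (c ∷ y)
... | inj₁ ∣cy∣≡0 rewrite dropLast-∷-empty b (c ∷ y) ∣cy∣≡0 = size≡0⇒last≡false (c ∷ y) ∣cy∣≡0
... | inj₂ 0<∣cy∣ rewrite dropLast-∷ b (c ∷ y) 0<∣cy∣ = last-dropLast (c ∷ y)

size-setLast : (x : Subset (suc n)) → last x ≡ false → size (x [ fromℕ n ]≔ true) ≡ suc (size x)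
size-setLast (false ∷ [])    _      = refl
size-setLast (true  ∷ c ∷ x) last-x = cong suc (size-setLast (c ∷ x) last-x)
size-setLast (false ∷ c ∷ x) last-x = size-setLast (c ∷ x) last-x

firstOnes : (N k : ℕ) → Subset N
firstOnes zero    k       = []
firstOnes (suc N) zero    = false ∷ firstOnes N zero
firstOnes (suc N) (suc k) = true ∷ firstOnes N k

size-firstOnes : ∀ N k → k ≤ N → size (firstOnes N k) ≡ k
size-firstOnes zero    zero    _       = refl
size-firstOnes (suc N) zero    _       = size-firstOnes N zero z≤n
size-firstOnes (suc N) (suc k) (s≤s p) = cong suc (size-firstOnes N k p)

firstOnes-least : ∀ {N} k (y : Subset N) → size y ≡ k → ¬ T (minInX y (firstOnes N k))
firstOnes-least k       []          _     ()
firstOnes-least zero    (false ∷ y) ∣y∣≡0 = firstOnes-least zero y ∣y∣≡0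
firstOnes-least (suc k) (true ∷ y)  ∣y∣≡k = firstOnes-least k y (suc-injective ∣y∣≡k)
firstOnes-least (suc k) (false ∷ y) _     ()

last-firstOnes : ∀ N k → k ≤ N → last (firstOnes (suc N) k) ≡ false
last-firstOnes zero    zero    _       = refl
last-firstOnes (suc N) zero    _       = last-firstOnes N zero z≤n
last-firstOnes (suc N) (suc k) (s≤s p) = last-firstOnes N k p

suc-half-≤ : ∀ s k → s + suc s ≡ suc (suc k) → suc s ≤ suc k
suc-half-≤ (suc s) k e = subst (suc (suc s) ≤_) (suc-injective e) (m≤n+m (suc (suc s)) s)

Consecutive : Subset n → Subset n → Set
Consecutive x y = x ≺ y × (∀ z → x ≺ z → ¬ z ≺ y)

gap-within-level : ∀ {m} (x : Subset (2 + m)) → last x ≡ false → size (∁ x) ≡ suc (size x) →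
  ∃ λ z → (true ∷ x) ≺ z × z ≺ ∁ (true ∷ x)
gap-within-level {m} x last-x ∣∁x∣ =
  true ∷ L , x≺L (minInX-trichotomy x L) , size≡⇒≺ (true ∷ L) (false ∷ ∁ x) (trans (cong suc ∣L∣) (sym ∣∁x∣)) _
  where
  s : ℕ
  s = size x
  s+s+1≡M : s + suc s ≡ 2 + m
  s+s+1≡M = trans (cong (s +_) (sym ∣∁x∣)) (size-∁ x)
  F L : Subset (2 + m)
  F = firstOnes (2 + m) (suc s)
  L = ∁ F
  ∣F∣ : size F ≡ suc s
  ∣F∣ = size-firstOnes (2 + m) (suc s) (subst (suc s ≤_) s+s+1≡M (m≤n+m (suc s) s))
  ∣L∣ : size L ≡ s
  ∣L∣ = +-cancelˡ-≡ (suc s) _ _ (trans (cong (_+ size L) (sym ∣F∣)) (trans (size-∁ F) (trans (sym s+s+1≡M) (+-comm s (suc s)))))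
  last-L : last L ≡ true
  last-L = trans (last-∁ F) (cong not (last-firstOnes (1 + m) (suc s) (suc-half-≤ s m s+s+1≡M)))
  x≺L : T (minInX x L) ⊎ x ≡ L ⊎ T (minInX L x) → (true ∷ x) ≺ (true ∷ L)
  x≺L (inj₁ p)          = size≡⇒≺ (true ∷ x) (true ∷ L) (cong suc (sym ∣L∣)) p
  x≺L (inj₂ (inj₁ x≡L)) = ⊥-elim (false≢true (trans (sym last-x) (trans (cong last x≡L) last-L)))
  x≺L (inj₂ (inj₂ p))   = ⊥-elim (firstOnes-least (suc s) (∁ x) ∣∁x∣
                            (subst T (trans (cong (minInX L) (sym (∁-involutive x))) (minInX-∁ F (∁ x))) p))

module _ {m : ℕ} (x : Subset (3 + m)) (last-x : last x ≡ false) where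

  private
    N s : ℕ
    N = 3 + m
    s = size x
    last-∁x : last (∁ x) ≡ true
    last-∁x = trans (last-∁ x) (cong not last-x)

  gap-by-size : suc s < size (∁ x) → ∃ λ z → x ≺ z × z ≺ ∁ x
  gap-by-size s+1<∣∁x∣ =
    z , size<⇒≺ x z (≤-reflexive (sym ∣z∣)) , size<⇒≺ z (∁ x) (subst (_< size (∁ x)) (sym ∣z∣) s+1<∣∁x∣)
    where
    z : Subset N
    z = x [ fromℕ (2 + m) ]≔ true
    ∣z∣ : size z ≡ suc s
    ∣z∣ = size-setLast x last-x

  gap-at-next-level : size (∁ x) ≡ suc s → ∃ λ z → x ≺ z × z ≺ ∁ x
  gap-at-next-level ∣∁x∣ = z , size<⇒≺ x z (≤-reflexive (sym ∣z∣)) , z≺∁x (minInX-trichotomy z (∁ x))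
    where
    s+s+1≡N : s + suc s ≡ N
    s+s+1≡N = trans (cong (s +_) (sym ∣∁x∣)) (size-∁ x)
    z : Subset N
    z = firstOnes N (suc s)
    ∣z∣ : size z ≡ suc s
    ∣z∣ = size-firstOnes N (suc s) (subst (suc s ≤_) s+s+1≡N (m≤n+m (suc s) s))
    z≺∁x : T (minInX z (∁ x)) ⊎ z ≡ ∁ x ⊎ T (minInX (∁ x) z) → z ≺ ∁ x
    z≺∁x (inj₁ p)          = size≡⇒≺ z (∁ x) (trans ∣z∣ (sym ∣∁x∣)) p
    z≺∁x (inj₂ (inj₁ z≡∁x)) = ⊥-elim (false≢true (trans (sym (last-firstOnes (2 + m) (suc s) (suc-half-≤ s (1 + m) s+s+1≡N)))
                                                      (trans (cong last z≡∁x) last-∁x)))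
    z≺∁x (inj₂ (inj₂ p))   = ⊥-elim (firstOnes-least (suc s) (∁ x) ∣∁x∣ p)

gap-below-∁ : ∀ {m} (x : Subset (3 + m)) → last x ≡ false → x ≺ ∁ x → ∃ λ z → x ≺ z × z ≺ ∁ x
gap-below-∁ x last-x x≺∁x with ≺-cases x (∁ x) x≺∁x
... | inj₁ ∣x∣<∣∁x∣ with m≤n⇒m<n∨m≡n ∣x∣<∣∁x∣
...   | inj₁ ∣x∣+1<∣∁x∣ = gap-by-size x last-x ∣x∣+1<∣∁x∣
...   | inj₂ ∣x∣+1≡∣∁x∣ = gap-at-next-level x last-x (sym ∣x∣+1≡∣∁x∣)
gap-below-∁ (true ∷ x) last-x _ | inj₂ (∣x∣≡∣∁x∣ , _) = gap-within-level x last-x (sym ∣x∣≡∣∁x∣)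
gap-below-∁ (false ∷ x) _     _ | inj₂ (_ , ())

¬consecutive-∁ : ∀ {m} (x : Subset (3 + m)) → last x ≡ false → ¬ Consecutive x (∁ x)
¬consecutive-∁ x last-x (x≺∁x , no-gap) =
  let (z , x≺z , z≺∁x) = gap-below-∁ x last-x x≺∁x in no-gap z x≺z z≺∁x

-- By gap-below-∁ only dimensions 1 and 2 occur; in dimension 2 the only case is y = 11, ∁ (dropLast y) = 01.
consecutive-∁-dropLast : (y : Subset (suc n)) → Consecutive (dropLast y) (∁ (dropLast y)) → dist (∁ (dropLast y)) y ≤ 1
consecutive-∁-dropLast {zero}        y                       _           = dist≤n (∁ (dropLast y)) y
consecutive-∁-dropLast {suc zero}    (true  ∷ true  ∷ [])    _           = s≤s z≤n
consecutive-∁-dropLast {suc zero}    (true  ∷ false ∷ [])    (_ , no-gap) = ⊥-elim (no-gap (true ∷ false ∷ []) _ _)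
consecutive-∁-dropLast {suc zero}    (false ∷ true  ∷ [])    (_ , no-gap) = ⊥-elim (no-gap (true ∷ false ∷ []) _ _)
consecutive-∁-dropLast {suc zero}    (false ∷ false ∷ [])    (_ , no-gap) = ⊥-elim (no-gap (true ∷ false ∷ []) _ _)
consecutive-∁-dropLast {suc (suc m)} y                       consecutive = ⊥-elim (¬consecutive-∁ (dropLast y) (last-dropLast y) consecutive)

differ-everywhere⇒∁ : (x y : Subset n) → (∀ i → lookup x i ≢ lookup y i) → y ≡ ∁ x
differ-everywhere⇒∁ []      []      _      = refl
differ-everywhere⇒∁ (a ∷ x) (b ∷ y) differ =
  cong₂ _∷_ (¬-not (differ zero ∘ sym)) (differ-everywhere⇒∁ x y (differ ∘ suc))

-- In a family whose sections are all down-sets, every inversion x ∉ A, y ∈ A with x ≺ y has y = ∁ x;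
-- then A = {z ≺ x} ∪ {∁ x} and its neighbourhood contains that of {z ≼ x}.
module _ {n : ℕ} (A : Family (suc n)) (compressed : ∀ i v → Downclosed (section i v A)) where

  inversion⇒antipodal : ∀ x y → x ≺ y → ¬ T (A x) → T (A y) → y ≡ ∁ x
  inversion⇒antipodal x y x≺y x∉A y∈A = differ-everywhere⇒∁ x y same-coordinate-impossible
    where
    same-coordinate-impossible : ∀ i → lookup x i ≢ lookup y i
    same-coordinate-impossible i xᵢ≡yᵢ = x∉A (subst (T ∘ A) x≡ (compressed i v (removeAt x i) (removeAt y i) x′≺y′ y′∈S))
      where
      v : Bool
      v = lookup y i
      x≡ : insertAt (removeAt x i) i v ≡ x
      x≡ = trans (cong (insertAt (removeAt x i) i) (sym xᵢ≡yᵢ)) (insertAt-removeAt x i)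
      y≡ : insertAt (removeAt y i) i v ≡ y
      y≡ = insertAt-removeAt y i
      x′≺y′ : removeAt x i ≺ removeAt y i
      x′≺y′ = subst T (simplicialLt-insertAt (removeAt x i) (removeAt y i) i v) (subst₂ _≺_ (sym x≡) (sym y≡) x≺y)
      y′∈S : T (section i v A (removeAt y i))
      y′∈S = subst (T ∘ A) (sym y≡) y∈A

  module _ (x y : Subset (suc n)) (x≺y : x ≺ y) (x∉A : ¬ T (A x)) (y∈A : T (A y)) where

    private
      x̄ : Subset (suc n)
      x̄ = ∁ x
      x̄∈A : T (A x̄)
      x̄∈A = subst (T ∘ A) (inversion⇒antipodal x y x≺y x∉A y∈A) y∈A
      x≺x̄ : x ≺ x̄
      x≺x̄ = subst (x ≺_) (inversion⇒antipodal x y x≺y x∉A y∈A) x≺y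

      ∈A-below-x̄ : ∀ z → z ≺ x̄ → T (A z) ⊎ z ≡ x
      ∈A-below-x̄ z z≺x̄ with T? (A z)
      ... | yes z∈A = inj₁ z∈A
      ... | no  z∉A = inj₂ (∁-injective (sym (inversion⇒antipodal z x̄ z≺x̄ z∉A x̄∈A)))

      x-x̄-consecutive : Consecutive x x̄
      x-x̄-consecutive = x≺x̄ , between
        where
        between : ∀ z → x ≺ z → ¬ z ≺ x̄
        between z x≺z z≺x̄ with ∈A-below-x̄ z z≺x̄
        ... | inj₁ z∈A = ≺-irrefl z (subst (z ≺_) (sym (inversion⇒antipodal x z x≺z x∉A z∈A)) z≺x̄)
        ... | inj₂ refl = ≺-irrefl z x≺z

      A≗ : A ≗ (λ z → below x z ∨ ⁅ x̄ ⁆ z)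
      A≗ z = T-ext into (λ p → [ below-x , at-x̄ ] (to T-∨ p))
        where
        into : T (A z) → T (below x z ∨ ⁅ x̄ ⁆ z)
        into z∈A with ≺-trichotomy z x
        ... | inj₁ z≺x        = from T-∨ (inj₁ z≺x)
        ... | inj₂ (inj₁ refl) = ⊥-elim (x∉A z∈A)
        ... | inj₂ (inj₂ x≺z) =
          from T-∨ (inj₂ (subst (T ∘ ⁅ x̄ ⁆) (sym (inversion⇒antipodal x z x≺z x∉A z∈A)) (∈⁅⁆ x̄)))
        below-x : z ≺ x → T (A z)
        below-x z≺x with ∈A-below-x̄ z (≺-trans z x x̄ z≺x x≺x̄)
        ... | inj₁ z∈A  = z∈A
        ... | inj₂ refl = ⊥-elim (≺-irrefl z z≺x)
        at-x̄ : T (⁅ x̄ ⁆ z) → T (A z)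
        at-x̄ z≡x̄ = subst (T ∘ A) (sym (∈⁅⁆⇒≡ x̄ z z≡x̄)) x̄∈A

      ∣A∣≡∣≼x∣ : count A ≡ count (atMost x)
      ∣A∣≡∣≼x∣ = begin
        count A                              ≡⟨ count-cong A≗ ⟩
        count (λ z → below x z ∨ ⁅ x̄ ⁆ z)
          ≡⟨ count-insert (below x) x̄ (λ x̄≺x → ≺-irrefl x (≺-trans x x̄ x x≺x̄ x̄≺x)) ⟩
        suc (rank x)                         ≡⟨ count-atMost x ⟨
        count (atMost x)                     ∎
        where open ≡-Reasoning

      ball-≼x⊆ball-A : ball 1 (atMost x) ⊆ ball 1 A
      ball-≼x⊆ball-A u u∈ball with ball-elim 1 (atMost x) u u∈ball
      ... | z , z≼x , zu≤1 with to T-∨ z≼x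
      ...   | inj₁ z≺x = ball-intro 1 A z u (subst T (sym (A≗ z)) (from T-∨ (inj₁ z≺x))) zu≤1
      ...   | inj₂ z≡x with dropLast-least x u (subst (λ z → dist z u ≤ 1) (∈⁅⁆⇒≡ x z z≡x) zu≤1)
      ...     | inj₁ u′≺x = ball-intro 1 A (dropLast u) u (subst T (sym (A≗ _)) (from T-∨ (inj₁ u′≺x))) (dist-dropLast u)
      ...     | inj₂ refl = ball-intro 1 A x̄ u x̄∈A (consecutive-∁-dropLast u x-x̄-consecutive)

    ball-1-segment-≤-inversion : count (ball 1 (segment (suc n) (count A))) ≤ count (ball 1 A)
    ball-1-segment-≤-inversion = begin
      count (ball 1 (segment (suc n) (count A)))
        ≡⟨ count-cong (ball-cong 1 (λ z → cong (λ k → segment (suc n) k z) ∣A∣≡∣≼x∣)) ⟩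
      count (ball 1 (segment (suc n) (count (atMost x))))
        ≡⟨ count-cong (ball-cong 1 (λ z → sym (downclosed≗segment (atMost x) (atMost-downclosed x) z))) ⟩
      count (ball 1 (atMost x))
        ≤⟨ count-mono ball-≼x⊆ball-A ⟩
      count (ball 1 A) ∎
      where open ≤-Reasoning


-- Harper's vertex-isoperimetric inequality

harper-step : Harper n → Harper (suc n)
harper-step {n} harper-n B = descend (suc (potential B)) B ≤-refl
  where
  descend : ∀ k A → potential A < k → count (ball 1 (segment (suc n) (count A))) ≤ count (ball 1 A)
  descend zero    A ()
  descend (suc k) A bound with any? (λ i → anySubset? (λ x → ¬? (compress i A x ≟ᵇ A x)))
  ... | yes (i , x , changed) = begin
    count (ball 1 (segment (suc n) (count A)))
      ≡⟨ cong (λ c → count (ball 1 (segment (suc n) c))) (count-compress i A) ⟨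
    count (ball 1 (segment (suc n) (count (compress i A))))
      ≤⟨ descend k (compress i A) (<-≤-trans (compress-potential-< i A x changed) (≤-pred bound)) ⟩
    count (ball 1 (compress i A))
      ≤⟨ compress-ball-≤ harper-n i A ⟩
    count (ball 1 A) ∎
    where open ≤-Reasoning
  ... | no unchanged
    with anySubset? (λ x → anySubset? (λ y → T? (simplicialLt x y) ×-dec ¬? (T? (A x)) ×-dec T? (A y)))
  ...   | yes (x , y , x≺y , x∉A , y∈A) = ball-1-segment-≤-inversion A compressed x y x≺y x∉A y∈A
    where
    compressed : ∀ i v → Downclosed (section i v A)
    compressed i v = downclosed-cong (λ z → trans (sym (section-compress i v A z)) (unchanged-at (insertAt z i v)))
                                     (segment-downclosed n (count (section i v A)))
      where
      unchanged-at : ∀ x → compress i A x ≡ A x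
      unchanged-at x with compress i A x ≟ᵇ A x
      ... | yes same    = same
      ... | no  changed = ⊥-elim (unchanged (i , x , changed))
  ...   | no no-inversion = ≤-reflexive (count-cong (ball-cong 1 (λ z → sym (downclosed≗segment A A↓ z))))
    where
    A↓ : Downclosed A
    A↓ x y x≺y y∈A with T? (A x)
    ... | yes x∈A = x∈A
    ... | no  x∉A = ⊥-elim (no-inversion (x , y , x≺y , x∉A , y∈A))

harper : ∀ n → Harper n
harper zero    B = ≤-reflexive (count-cong (ball-cong 1 (λ z → sym (downclosed≗segment B (λ { [] [] () }) z))))
harper (suc n) = harper-step (harper n)

ball-harper : ∀ r (A : Family n) → count (ball r (segment n (count A))) ≤ count (ball r A)
ball-harper {n} zero A = ≤-reflexive (begin
  count (ball 0 (segment n (count A)))  ≡⟨ count-cong (ball-zero (segment n (count A))) ⟩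
  count (segment n (count A))           ≡⟨ count-segment n A ⟩
  count A                               ≡⟨ count-cong (ball-zero A) ⟨
  count (ball 0 A)                      ∎)
  where open ≡-Reasoning
ball-harper {n} (suc r) A = begin
  count (ball (suc r) I)                        ≡⟨ count-cong (ball-suc r I) ⟩
  count (ball 1 (ball r I))
    ≡⟨ count-cong (ball-cong 1 (downclosed≗segment (ball r I) (ball-downclosed r I (segment-downclosed n (count A))))) ⟩
  count (ball 1 (segment n (count (ball r I)))) ≤⟨ count-mono (ball-mono 1 (segment-mono n (ball-harper r A))) ⟩
  count (ball 1 (segment n (count (ball r A)))) ≤⟨ harper n (ball r A) ⟩
  count (ball 1 (ball r A))                     ≡⟨ count-cong (ball-suc r A) ⟨
  count (ball (suc r) A)                        ∎
  where
  open ≤-Reasoning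
  I : Family n
  I = segment n (count A)


-- The sets C^p[A]

T-allᵇ : ∀ {X : Set} (f : X → Bool) (xs : List X) → T (allᵇ f xs) → All (T ∘ f) xs
T-allᵇ f []       _ = []
T-allᵇ f (x ∷ xs) p = let (fx , rest) = to T-∧ p in fx ∷ T-allᵇ f xs rest

allᵇ-T : ∀ {X : Set} (f : X → Bool) (xs : List X) → All (T ∘ f) xs → T (allᵇ f xs)
allᵇ-T f []       []          = _
allᵇ-T f (x ∷ xs) (fx ∷ rest) = from T-∧ (fx , allᵇ-T f xs rest)

∈-allSubsets : (x : Subset n) → x ∈ allSubsets n
∈-allSubsets []          = here refl
∈-allSubsets (true ∷ x)  = ∈-++⁺ˡ (∈-map⁺ (true ∷_) (∈-allSubsets x))
∈-allSubsets (false ∷ x) = ∈-++⁺ʳ (map (true ∷_) (allSubsets _)) (∈-map⁺ (false ∷_) (∈-allSubsets x))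

T-allᵇ-allSubsets : (f : Family n) → T (allᵇ f (allSubsets n)) ⇔ (∀ x → T (f x))
T-allᵇ-allSubsets {n} f =
  mk⇔ (λ p x → All.lookup (T-allᵇ f (allSubsets n) p) (∈-allSubsets x))
      (λ p → allᵇ-T f (allSubsets n) (All.tabulate (λ {x} _ → p x)))

far⇔near-antipode : ∀ {a b n p} → a + b ≡ n → p < n → p < a ⇔ b ≤ n ∸ suc p
far⇔near-antipode {a} {b} {n} {p} a+b≡n p<n = mk⇔ far⇒near near⇒far
  where
  far⇒near : p < a → b ≤ n ∸ suc p
  far⇒near p<a = subst (_≤ n ∸ suc p) (trans (cong (_∸ a) (sym a+b≡n)) (m+n∸m≡n a b)) (∸-monoʳ-≤ n p<a)
  near⇒far : b ≤ n ∸ suc p → p < a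
  near⇒far b≤ with p <? a
  ... | yes p<a = p<a
  ... | no  p≮a = ⊥-elim (<-irrefl a+b≡n (begin-strict
    a + b              ≤⟨ +-mono-≤ (≮⇒≥ p≮a) b≤ ⟩
    p + (n ∸ suc p)    <⟨ +-monoˡ-< (n ∸ suc p) (n<1+n p) ⟩
    suc p + (n ∸ suc p) ≡⟨ m+[n∸m]≡n p<n ⟩
    n                  ∎))
    where open ≤-Reasoning

allᵇ-cong : ∀ {X : Set} {f g : X → Bool} → (∀ x → f x ≡ g x) → ∀ xs → allᵇ f xs ≡ allᵇ g xs
allᵇ-cong f≗g []       = refl
allᵇ-cong f≗g (x ∷ xs) = cong₂ _∧_ (f≗g x) (allᵇ-cong f≗g xs)

C-cong : ∀ {n} p {A B : Family n} → A ≗ B → C p A ≗ C p B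
C-cong {n} p A≗B y = allᵇ-cong (λ x → cong (λ b → not b ∨ (dist x y ≤ᵇ p)) (A≗B x)) (allSubsets n)

C≗¬ball-∁ : ∀ {n} p (A : Family n) → p < n → C p A ≗ (λ y → not (ball (n ∸ suc p) A (∁ y)))
C≗¬ball-∁ {n} p A p<n y = T-ext into (λ ∁y∉ball → from (T-allᵇ-allSubsets _) (outof (T-not⇒¬T ∁y∉ball)))
  where
  r : ℕ
  r = n ∸ suc p
  into : T (C p A y) → T (not (ball r A (∁ y)))
  into y∈C = ¬T⇒T-not λ ∁y∈ball →
    let (x , x∈A , x∁y≤r) = ball-elim r A (∁ y) ∁y∈ball in
    [ (λ x∉A → T-not⇒¬T x∉A x∈A)
    , (λ xy≤p → <⇒≱ (from (far⇔near-antipode (dist-∁ x y) p<n) x∁y≤r) (≤ᵇ⇒≤ _ _ xy≤p)) ]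
      (to T-∨ (to (T-allᵇ-allSubsets _) y∈C x))
  outof : ¬ T (ball r A (∁ y)) → ∀ x → T (not (A x) ∨ (dist x y ≤ᵇ p))
  outof ∁y∉ball x with T? (A x) | p <? dist x y
  ... | no  x∉A | _       = from T-∨ (inj₁ (¬T⇒T-not x∉A))
  ... | yes x∈A | yes far = ⊥-elim (∁y∉ball (ball-intro r A x (∁ y) x∈A (to (far⇔near-antipode (dist-∁ x y) p<n) far)))
  ... | yes _   | no  ¬far = from T-∨ (inj₂ (≤⇒≤ᵇ (≮⇒≥ ¬far)))

count-C+count-ball : ∀ {n} p (A : Family n) → p < n → count (C p A) + count (ball (n ∸ suc p) A) ≡ 2 ^ n
count-C+count-ball {n} p A p<n = begin
  count (C p A) + count (ball r A)
    ≡⟨ cong₂ _+_ (count-cong (C≗¬ball-∁ p A p<n)) (sym (count-∘∁ (ball r A))) ⟩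
  count (not ∘ ball r A ∘ ∁) + count (ball r A ∘ ∁)
    ≡⟨ +-comm (count (not ∘ ball r A ∘ ∁)) _ ⟩
  count (ball r A ∘ ∁) + count (not ∘ ball r A ∘ ∁)
    ≡⟨ count-complement (ball r A ∘ ∁) ⟩
  2 ^ n ∎
  where
  open ≡-Reasoning
  r : ℕ
  r = n ∸ suc p

C-full : ∀ {n} p (A : Family n) → n ≤ p → C p A ≗ (λ _ → true)
C-full p A n≤p y =
  T-ext (λ _ → _) (λ _ → from (T-allᵇ-allSubsets _) (λ x → from T-∨ (inj₂ (≤⇒≤ᵇ (≤-trans (dist≤n x y) n≤p)))))

complement-≤ : ∀ {a b a′ b′} → a + b ≡ a′ + b′ → b′ ≤ b → a ≤ a′
complement-≤ {a} {b} {a′} {b′} a+b≡a′+b′ b′≤b =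
  +-cancelʳ-≤ b′ a a′ (≤-trans (+-monoʳ-≤ a b′≤b) (≤-reflexive a+b≡a′+b′))

count-C-≤ : ∀ n p (A : Family n) → count (C p A) ≤ count (C p (segment n (count A)))
count-C-≤ n p A with p <? n
... | yes p<n = complement-≤ (trans (count-C+count-ball p A p<n) (sym (count-C+count-ball p I p<n)))
                             (ball-harper (n ∸ suc p) A)
  where
  I : Family n
  I = segment n (count A)
... | no  p≮n = ≤-reflexive (trans (count-cong (C-full p A (≮⇒≥ p≮n)))
                                   (sym (count-cong (C-full p (segment n (count A)) (≮⇒≥ p≮n)))))

theorem3p3 : (n p : ℕ) (A : Family n) →
    card (C p A) ≤ card (C p (initialSegment n (card A)))
theorem3p3 n p A = begin
  card (C p A)                             ≡⟨ card≡count (C p A) ⟩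
  count (C p A)                            ≤⟨ count-C-≤ n p A ⟩
  count (C p (segment n (count A)))        ≡⟨ count-cong (C-cong p segment≗initialSegment) ⟩
  count (C p (initialSegment n (card A)))  ≡⟨ card≡count (C p (initialSegment n (card A))) ⟨
  card (C p (initialSegment n (card A)))   ∎
  where
  open ≤-Reasoning
  segment≗initialSegment : segment n (count A) ≗ initialSegment n (card A)
  segment≗initialSegment x =
    sym (trans (initialSegment≗segment n (card A) x) (cong (λ m → segment n m x) (card≡count A)))
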